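{- Let $G$ be a graph such that every connected component of $G$ has at least three vertices. Then there exists a minimum $\Delta$-completion set $F$ of $G$ such that for every edge $uv\in F$ we have $N_G(u)\cap N_G(v)\neq\emptyset$, that is, $\mathsf{dist}_G(u,v)=2$.
   Context: All graphs are finite and simple, not necessarily connected. A graph is triangle-covered if every vertex belongs to at least one triangle. A $\Delta$-completion set of $G$ is a set $F$ of non-edges of $G$ such that $G+F$ is triangle-covered; it is minimum if it has the smallest possible size. $N_G(v)$ is the set of neighbours of $v$ in $G$ and $\mathsf{dist}_G(u,v)$ is the length of a shortest $u$–$v$ path in $G$. -}

module Defs where

open import Data.Nat using (ℕ; _≤_)
open import Data.Fin using (Fin; _<?_; _<_)
open import Data.Fin.Base using () 
open import Data.Bool using (Bool; true; false; _∨_; T; T?)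
open import Data.List using (List; length; filter; concatMap)
open import Data.List using (allFin) public
open import Data.Product using (_×_; _,_; proj₁; proj₂; Σ; ∃; ∃-syntax)
open import Relation.Nullary.Decidable using (_×-dec_)
open import Relation.Binary.PropositionalEquality using (_≡_; _≢_; cong₂)

record Graph (n : ℕ) : Set where
  field
    adj    : Fin n → Fin n → Bool
    sym    : ∀ u v → adj u v ≡ adj v u
    irrefl : ∀ v → adj v v ≡ false
open Graph public

Adj : ∀ {n} → Graph n → Fin n → Fin n → Set
Adj G u v = adj G u v ≡ true

data Reach {n : ℕ} (G : Graph n) : Fin n → Fin n → Set where
  here : ∀ {v} → Reach G v v
  step : ∀ {u w v} → Adj G u w → Reach G w v → Reach G u v

ComponentsAtLeast3 : ∀ {n} → Graph n → Set
ComponentsAtLeast3 {n} G = ∀ (v : Fin n) →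
  ∃[ a ] ∃[ b ] ∃[ c ]
    (a ≢ b × a ≢ c × b ≢ c × Reach G v a × Reach G v b × Reach G v c)

TriangleCovered : ∀ {n} → Graph n → Set
TriangleCovered {n} G = ∀ (v : Fin n) →
  ∃[ a ] ∃[ b ] (Adj G v a × Adj G v b × Adj G a b)

_⊕_ : ∀ {n} → Graph n → Graph n → Graph n
adj    (G ⊕ F) u v = adj G u v ∨ adj F u v
sym    (G ⊕ F) u v = cong₂ _∨_ (sym G u v) (sym F u v)
irrefl (G ⊕ F) v   = cong₂ _∨_ (irrefl G v) (irrefl F v)

-- F (a set of vertex pairs, represented as a graph) consists of non-edges of G
NonEdgesOf : ∀ {n} → Graph n → Graph n → Set
NonEdgesOf {n} G F = ∀ (u v : Fin n) → Adj F u v → adj G u v ≡ false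

allPairs : ∀ n → List (Fin n × Fin n)
allPairs n = concatMap (λ u → Data.List.map (λ v → (u , v)) (allFin n)) (allFin n)

size : ∀ {n} → Graph n → ℕ
size {n} F = length (filter (λ p → (proj₁ p <? proj₂ p) ×-dec T? (adj F (proj₁ p) (proj₂ p))) (allPairs n))

IsΔCompletion : ∀ {n} → Graph n → Graph n → Set
IsΔCompletion G F = NonEdgesOf G F × TriangleCovered (G ⊕ F)

IsMinΔCompletion : ∀ {n} → Graph n → Graph n → Set
IsMinΔCompletion {n} G F =
  IsΔCompletion G F × (∀ (F' : Graph n) → IsΔCompletion G F' → size F ≤ size F')

{-# OPTIONS --safe #-}
-- Split a minimum Δ-completion F into the edges A joining the two ends of a cherry p – q – r of G
-- (these are at distance two) and the remaining edges B. Every vertex z left uncovered by G + A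
-- is "backed" by B: it has two B-edges, or a B-edge to a covered vertex, or a B-path z – a – b with
-- zb ∈ G. Since every component has at least three vertices, every vertex and every edge of G lies
-- on a cherry, and adding its closing edge pr covers p, q and r. So B-edges can be traded for
-- closing edges one for one (two for two along a B-path) while the backing survives, until every
-- uncovered vertex has two B-edges; by the handshake lemma there are then at most |B| uncovered
-- vertices, each covered by one more closing edge. The result is a Δ-completion of size at most
-- |A| + |B| = |F|, hence again minimum, all of whose edges are at distance two. Edges are counted
-- as halved degree sums.
module Submission where

open import Defs
open import Data.Nat using (ℕ)
open import Data.Fin using (Fin)
open import Data.Product using (_×_; ∃-syntax)

open import Data.Nat.Properties using (+-*-semiring)
open import Algebra.Properties.Semiring.Sum +-*-semiring
  using (sum; sum-syntax; ∑-distrib-+; ∑-comm; *-distribˡ-sum; sum-cong-≗; sum-replicate-zero)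
open import Data.Bool using (Bool; true; false; _∧_; _∨_; not; T?) renaming (_≟_ to _≟ᵇ_)
open import Data.Bool.Properties using (¬-not; ∨-comm; ∨-zeroʳ; ∨-idem; ∧-zeroʳ; ∧-identityʳ)
open import Data.Empty using (⊥; ⊥-elim)
open import Data.Fin using (zero; suc; _≟_; _<?_; combine; remQuot)
open import Data.Fin.Properties
  using (any?; all?; ¬∀⟶∃¬; <-cmp; <-asym; <-irrefl; remQuot-combine)
open import Data.Fin.Subset using (Subset)
open import Data.Fin.Subset.Properties using (anySubset?)
open import Data.List using (List; length; filter; concatMap; map; tabulate; _++_)
open import Data.List.Properties using (length-++; filter-++; map-tabulate)
open import Data.Nat using (zero; suc; _+_; _*_; _≤_; _<_; _≤?_; z≤n)
open import Data.Nat.Induction using (<-wellFounded)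
open import Data.Nat.Properties
  using ( ≤-refl; ≤-trans; ≤-reflexive; ≰⇒>; m≤m+n; m≤n+m; +-assoc; +-comm; +-identityʳ
        ; *-identityˡ; +-mono-≤; +-monoˡ-≤; +-monoʳ-≤; +-mono-<-≤; +-mono-≤-<; *-suc; *-monoʳ-≤
        ; *-cancelˡ-≤; *-cancelˡ-≡; module ≤-Reasoning)
open import Data.Product using (_,_; proj₁; proj₂; Σ; uncurry)
open import Data.Sum using (_⊎_; inj₁; inj₂; [_,_]′)
open import Data.Vec using (lookup)
import Data.Vec as Vec
open import Data.Vec.Properties using (lookup∘tabulate)
open import Function using (_∘_; mk⇔)
open import Induction.WellFounded using (Acc; acc)
open import Relation.Binary using (tri<; tri≈; tri>)
open import Relation.Binary.PropositionalEquality as ≡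
  using (_≡_; _≢_; refl; cong; cong₂; trans; subst; subst₂; module ≡-Reasoning)
open import Relation.Nullary using (¬_; Dec; yes; no; does; contradiction)
open import Relation.Nullary.Decidable
  using (_×-dec_; _→-dec_; ¬?; map′; dec-true; dec-false; does-⇔; decidable-stable)

bit : Bool → ℕ
bit false = 0
bit true  = 1

∧-true⁻ : ∀ a {b} → a ∧ b ≡ true → a ≡ true × b ≡ true
∧-true⁻ true e = refl , e

does⇒ : ∀ {P : Set} (p : Dec P) → does p ≡ true → P
does⇒ (yes p) _ = p

_==_ : ∀ {n} → Fin n → Fin n → Bool
u == v = does (u ≟ v)

==-refl : ∀ {n} (u : Fin n) → u == u ≡ true
==-refl u = dec-true (u ≟ u) refl

==⇒≡ : ∀ {n} {u v : Fin n} → u == v ≡ true → u ≡ v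
==⇒≡ {u = u} {v} u==v = does⇒ (u ≟ v) u==v

==-sym : ∀ {n} (u v : Fin n) → u == v ≡ v == u
==-sym u v = does-⇔ (mk⇔ ≡.sym ≡.sym) (u ≟ v) (v ≟ u)

bit-mono : ∀ {a b} → (a ≡ true → b ≡ true) → bit a ≤ bit b
bit-mono {false} _   = z≤n
bit-mono {true}  a⇒b rewrite a⇒b refl = ≤-refl

bit-does-mono : ∀ {P Q : Set} → (P → Q) → (p : Dec P) (q : Dec Q) → bit (does p) ≤ bit (does q)
bit-does-mono P⇒Q (no _)  _       = z≤n
bit-does-mono P⇒Q (yes _) (yes _) = ≤-refl
bit-does-mono P⇒Q (yes p) (no ¬q) = contradiction (P⇒Q p) ¬q

bit-does-< : ∀ {P Q : Set} → ¬ P → Q → (p : Dec P) (q : Dec Q) → bit (does p) < bit (does q)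
bit-does-< ¬p q (yes p) _       = contradiction p ¬p
bit-does-< ¬p q (no _)  (yes _) = ≤-refl
bit-does-< ¬p q (no _)  (no ¬q) = contradiction q ¬q

+-transfer : ∀ {a₁ a c b₁ b} → a₁ ≤ a + c → c + b₁ ≤ b → a₁ + b₁ ≤ a + b
+-transfer {a₁} {a} {c} {b₁} {b} a₁≤a+c c+b₁≤b = begin
  a₁ + b₁       ≤⟨ +-monoˡ-≤ b₁ a₁≤a+c ⟩
  a + c + b₁    ≡⟨ +-assoc a c b₁ ⟩
  a + (c + b₁)  ≤⟨ +-monoʳ-≤ a c+b₁≤b ⟩
  a + b         ∎
  where open ≤-Reasoning

least-upward-closed : ∀ {P : ℕ → Set} → (∀ k → Dec (P k)) → (∀ {i j} → i ≤ j → P i → P j) →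
  ∀ {m} → P m → ∃[ k ] (P k × ∀ {j} → P j → k ≤ j)
least-upward-closed P? up {zero}  P0 = 0 , P0 , λ _ → z≤n
least-upward-closed P? up {suc m} P[1+m] with P? m
... | yes Pm = least-upward-closed P? up Pm
... | no ¬Pm = suc m , P[1+m] , λ Pj → ≰⇒> (λ j≤m → ¬Pm (up j≤m Pj))

no-three-in-two : ∀ {A : Set} {x w a b c : A} → a ≢ b → a ≢ c → b ≢ c →
  a ≡ x ⊎ a ≡ w → b ≡ x ⊎ b ≡ w → c ≡ x ⊎ c ≡ w → ⊥
no-three-in-two a≢b _   _   (inj₁ refl) (inj₁ refl) _           = a≢b refl
no-three-in-two a≢b _   _   (inj₂ refl) (inj₂ refl) _           = a≢b refl
no-three-in-two _   a≢c _   (inj₁ refl) (inj₂ refl) (inj₁ refl) = a≢c refl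
no-three-in-two _   _   b≢c (inj₁ refl) (inj₂ refl) (inj₂ refl) = b≢c refl
no-three-in-two _   _   b≢c (inj₂ refl) (inj₁ refl) (inj₁ refl) = b≢c refl
no-three-in-two _   a≢c _   (inj₂ refl) (inj₁ refl) (inj₂ refl) = a≢c refl

∑-mono-≤ : ∀ {n} {f g : Fin n → ℕ} → (∀ i → f i ≤ g i) → sum f ≤ sum g
∑-mono-≤ {zero}  f≤g = z≤n
∑-mono-≤ {suc n} f≤g = +-mono-≤ (f≤g zero) (∑-mono-≤ (f≤g ∘ suc))

∑-mono-< : ∀ {n} {f g : Fin n → ℕ} → (∀ i → f i ≤ g i) → ∀ j → f j < g j → sum f < sum g
∑-mono-< f≤g zero    fj<gj = +-mono-<-≤ fj<gj (∑-mono-≤ (f≤g ∘ suc))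
∑-mono-< f≤g (suc j) fj<gj = +-mono-≤-< (f≤g zero) (∑-mono-< (f≤g ∘ suc) j fj<gj)

≤-∑ : ∀ {n} (f : Fin n → ℕ) i → f i ≤ sum f
≤-∑ f zero    = m≤m+n (f zero) _
≤-∑ f (suc i) = ≤-trans (≤-∑ (f ∘ suc) i) (m≤n+m _ (f zero))

+≤-∑ : ∀ {n} (f : Fin n → ℕ) i j → i ≢ j → f i + f j ≤ sum f
+≤-∑ f zero    zero    i≢j = contradiction refl i≢j
+≤-∑ f zero    (suc j) _   = +-monoʳ-≤ (f zero) (≤-∑ (f ∘ suc) j)
+≤-∑ f (suc i) zero    _   =
  ≤-trans (≤-reflexive (+-comm (f (suc i)) (f zero))) (+-monoʳ-≤ (f zero) (≤-∑ (f ∘ suc) i))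
+≤-∑ f (suc i) (suc j) i≢j = ≤-trans (+≤-∑ (f ∘ suc) i j (i≢j ∘ cong suc)) (m≤n+m _ (f zero))

∑-indicator : ∀ {n} (r : Fin n) → (∑[ v < n ] bit (v == r)) ≡ 1
∑-indicator {suc n} zero    = cong suc (sum-replicate-zero n)
∑-indicator {suc n} (suc r) = ∑-indicator r

∑-∧-indicator : ∀ {n} c (r : Fin n) → (∑[ v < n ] bit (c ∧ v == r)) ≡ bit c
∑-∧-indicator {n} false r = sum-replicate-zero n
∑-∧-indicator     true  r = ∑-indicator r

∑∑-indicator : ∀ {n} (p r : Fin n) → (∑[ u < n ] ∑[ v < n ] bit (u == p ∧ v == r)) ≡ 1
∑∑-indicator p r = trans (sum-cong-≗ λ u → ∑-∧-indicator (u == p) r) (∑-indicator p)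

length-filter-tabulate : ∀ {A : Set} {P : A → Set} (P? : ∀ x → Dec (P x)) {k} (f : Fin k → A) →
  length (filter P? (tabulate f)) ≡ ∑[ i < k ] bit (does (P? (f i)))
length-filter-tabulate P? {zero}  f = refl
length-filter-tabulate P? {suc k} f with does (P? (f zero))
... | true  = cong suc (length-filter-tabulate P? (f ∘ suc))
... | false = length-filter-tabulate P? (f ∘ suc)

length-filter-concatMap : ∀ {A B : Set} {P : B → Set} (P? : ∀ x → Dec (P x))
  (g : A → List B) {k} (f : Fin k → A) →
  length (filter P? (concatMap g (tabulate f))) ≡ ∑[ i < k ] length (filter P? (g (f i)))
length-filter-concatMap P? g {zero}  f = refl
length-filter-concatMap P? g {suc k} f = begin
  length (filter P? (g (f zero) ++ rest))
    ≡⟨ cong length (filter-++ P? (g (f zero)) rest) ⟩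
  length (filter P? (g (f zero)) ++ filter P? rest)
    ≡⟨ length-++ (filter P? (g (f zero))) ⟩
  length (filter P? (g (f zero))) + length (filter P? rest)
    ≡⟨ cong (length (filter P? (g (f zero))) +_) (length-filter-concatMap P? g (f ∘ suc)) ⟩
  length (filter P? (g (f zero))) + ∑[ i < k ] length (filter P? (g (f (suc i))))
    ∎
  where
  open ≡-Reasoning
  rest = concatMap g (tabulate (f ∘ suc))

module _ {n : ℕ} where

  _⊆_ : Graph n → Graph n → Set
  X ⊆ Y = ∀ u v → Adj X u v → Adj Y u v

  _≐_ : Graph n → Graph n → Set
  X ≐ Y = ∀ u v → adj X u v ≡ adj Y u v

  ≐-sym : {X Y : Graph n} → X ≐ Y → Y ≐ X
  ≐-sym X≐Y u v = ≡.sym (X≐Y u v)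

  ≐⇒⊆ : {X Y : Graph n} → X ≐ Y → X ⊆ Y
  ≐⇒⊆ X≐Y u v uv = trans (≡.sym (X≐Y u v)) uv

  adj? : (X : Graph n) → ∀ u v → Dec (Adj X u v)
  adj? X u v = adj X u v ≟ᵇ true

  Adj-sym : (X : Graph n) {u v : Fin n} → Adj X u v → Adj X v u
  Adj-sym X {u} {v} uv = trans (sym X v u) uv

  Adj⇒≢ : (X : Graph n) {u v : Fin n} → Adj X u v → u ≢ v
  Adj⇒≢ X {u} uv refl with trans (≡.sym uv) (irrefl X u)
  ... | ()

  X⊆X⊕Y : (X Y : Graph n) → X ⊆ (X ⊕ Y)
  X⊆X⊕Y X Y u v uv rewrite uv = refl

  Y⊆X⊕Y : (X Y : Graph n) → Y ⊆ (X ⊕ Y)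
  Y⊆X⊕Y X Y u v uv rewrite uv = ∨-zeroʳ (adj X u v)

  ⊕-elim : (X Y : Graph n) {u v : Fin n} → Adj (X ⊕ Y) u v → Adj X u v ⊎ Adj Y u v
  ⊕-elim X Y {u} {v} uv with adj X u v
  ... | true  = inj₁ refl
  ... | false = inj₂ uv

  ⊕-monoʳ : (X : Graph n) {Y Z : Graph n} → Y ⊆ Z → (X ⊕ Y) ⊆ (X ⊕ Z)
  ⊕-monoʳ X {Y} {Z} Y⊆Z u v uv = [ X⊆X⊕Y X Z u v , Y⊆X⊕Y X Z u v ∘ Y⊆Z u v ]′ (⊕-elim X Y uv)

  _∩_ : Graph n → Graph n → Graph n
  adj    (X ∩ Y) u v = adj X u v ∧ adj Y u v
  sym    (X ∩ Y) u v = cong₂ _∧_ (sym X u v) (sym Y u v)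
  irrefl (X ∩ Y) v rewrite irrefl X v = refl

  _∖_ : Graph n → Graph n → Graph n
  adj    (X ∖ Y) u v = adj X u v ∧ not (adj Y u v)
  sym    (X ∖ Y) u v = cong₂ (λ a b → a ∧ not b) (sym X u v) (sym Y u v)
  irrefl (X ∖ Y) v rewrite irrefl X v = refl

  ∩-intro : (X Y : Graph n) {u v : Fin n} → Adj X u v → Adj Y u v → Adj (X ∩ Y) u v
  ∩-intro X Y xuv yuv rewrite xuv | yuv = refl

  ∩-elim : (X Y : Graph n) {u v : Fin n} → Adj (X ∩ Y) u v → Adj X u v × Adj Y u v
  ∩-elim X Y {u} {v} uv with adj X u v | adj Y u v
  ... | true | true = refl , refl

  ∖-intro : (X Y : Graph n) {u v : Fin n} → Adj X u v → ¬ Adj Y u v → Adj (X ∖ Y) u v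
  ∖-intro X Y {u} {v} xuv ¬yuv rewrite xuv with adj Y u v
  ... | false = refl
  ... | true  = contradiction refl ¬yuv

  ∖-elim : (X Y : Graph n) {u v : Fin n} → Adj (X ∖ Y) u v → Adj X u v × ¬ Adj Y u v
  ∖-elim X Y {u} {v} uv with adj X u v | adj Y u v
  ... | true | false = refl , λ ()

  X∖Y⊆X : (X Y : Graph n) → (X ∖ Y) ⊆ X
  X∖Y⊆X X Y u v = proj₁ ∘ ∖-elim X Y

  ⊕-split : (X Y Z : Graph n) {u v : Fin n} → Adj (X ⊕ Y) u v →
    Adj X u v ⊎ Adj (Y ∩ Z) u v ⊎ Adj (Y ∖ Z) u v
  ⊕-split X Y Z {u} {v} uv with ⊕-elim X Y uv
  ... | inj₁ xuv = inj₁ xuv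
  ... | inj₂ yuv with adj? Z u v
  ...   | yes zuv = inj₂ (inj₁ (∩-intro Y Z yuv zuv))
  ...   | no ¬zuv = inj₂ (inj₂ (∖-intro Y Z yuv ¬zuv))

  ∅ : Graph n
  adj    ∅ u v = false
  sym    ∅ u v = refl
  irrefl ∅ v   = refl

  symmetrise : (Fin n → Fin n → Bool) → Graph n
  adj    (symmetrise R) u v = (R u v ∨ R v u) ∧ not (u == v)
  sym    (symmetrise R) u v = cong₂ (λ a b → a ∧ not b) (∨-comm (R u v) (R v u)) (==-sym u v)
  irrefl (symmetrise R) v rewrite ==-refl v = ∧-zeroʳ _

  symmetrise-intro : ∀ R {u v} → R u v ≡ true → u ≢ v → Adj (symmetrise R) u v
  symmetrise-intro R {u} {v} Ruv u≢v rewrite Ruv | dec-false (u ≟ v) u≢v = refl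

  symmetrise-elim : ∀ R {u v} → Adj (symmetrise R) u v → R u v ≡ true ⊎ R v u ≡ true
  symmetrise-elim R {u} {v} uv with R u v | R v u
  ... | true  | _    = inj₁ refl
  ... | false | true = inj₂ refl
  ... | false | false with () ← uv

  edge : Fin n → Fin n → Graph n
  edge p r = symmetrise (λ u v → u == p ∧ v == r)

  edge-adj : {p r : Fin n} → p ≢ r → Adj (edge p r) p r
  edge-adj {p} {r} = symmetrise-intro (λ u v → u == p ∧ v == r) (cong₂ _∧_ (==-refl p) (==-refl r))

  edge-ends : {p r u v : Fin n} → Adj (edge p r) u v → (u ≡ p × v ≡ r) ⊎ (u ≡ r × v ≡ p)
  edge-ends {p} {r} {u} {v} uv with symmetrise-elim (λ u v → u == p ∧ v == r) {u} {v} uv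
  ... | inj₁ e = let u==p , v==r = ∧-true⁻ (u == p) e in inj₁ (==⇒≡ u==p , ==⇒≡ v==r)
  ... | inj₂ e = let v==p , u==r = ∧-true⁻ (v == p) e in inj₂ (==⇒≡ u==r , ==⇒≡ v==p)

  ∖-edge-keeps : (X : Graph n) {p r u v : Fin n} → Adj X u v → u ≢ p → u ≢ r → Adj (X ∖ edge p r) u v
  ∖-edge-keeps X {p} {r} xuv u≢p u≢r =
    ∖-intro X (edge p r) xuv λ e → [ u≢p ∘ proj₁ , u≢r ∘ proj₁ ]′ (edge-ends e)

  Covered : Graph n → Fin n → Set
  Covered X z = ∃[ a ] ∃[ b ] (Adj X z a × Adj X z b × Adj X a b)

  covered? : (X : Graph n) (z : Fin n) → Dec (Covered X z)
  covered? X z = any? λ a → any? λ b → adj? X z a ×-dec adj? X z b ×-dec adj? X a b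

  Covered-mono : {X Y : Graph n} → X ⊆ Y → ∀ z → Covered X z → Covered Y z
  Covered-mono X⊆Y z (a , b , za , zb , ab) = a , b , X⊆Y _ _ za , X⊆Y _ _ zb , X⊆Y _ _ ab

  triangle-covered : (X : Graph n) {a b c x : Fin n} → Adj X a b → Adj X b c → Adj X a c →
    x ≡ a ⊎ x ≡ b ⊎ x ≡ c → Covered X x
  triangle-covered X {a} {b} {c} ab bc ac (inj₁ refl)        = b , c , ab , ac , bc
  triangle-covered X {a} {b} {c} ab bc ac (inj₂ (inj₁ refl)) = a , c , Adj-sym X ab , bc , ac
  triangle-covered X {a} {b} {c} ab bc ac (inj₂ (inj₂ refl)) = a , b , Adj-sym X ac , Adj-sym X bc , ab

  TwoNeighbours : Graph n → Fin n → Set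
  TwoNeighbours X z = ∃[ a ] ∃[ a′ ] (a ≢ a′ × Adj X z a × Adj X z a′)

  twoNeighbours? : (X : Graph n) (z : Fin n) → Dec (TwoNeighbours X z)
  twoNeighbours? X z = any? λ a → any? λ a′ → ¬? (a ≟ a′) ×-dec adj? X z a ×-dec adj? X z a′

  Reach-closed : (X : Graph n) {S : Fin n → Set} → (∀ {y z} → S y → Adj X y z → S z) →
    ∀ {s t} → Reach X s t → S s → S t
  Reach-closed X closed here       Ss = Ss
  Reach-closed X closed (step e r) Ss = Reach-closed X closed r (closed Ss e)

  Reach⇒neighbour : (X : Graph n) {x t : Fin n} → Reach X x t → t ≢ x → ∃[ w ] Adj X x w
  Reach⇒neighbour X here       t≢x = contradiction refl t≢x
  Reach⇒neighbour X (step e _) _   = _ , e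

  -- Degree sums and edge counts

  degree : Graph n → Fin n → ℕ
  degree X u = ∑[ v < n ] bit (adj X u v)

  degreeSum : Graph n → ℕ
  degreeSum X = ∑[ u < n ] degree X u

  degreeSum-mono : {X Y : Graph n} → X ⊆ Y → degreeSum X ≤ degreeSum Y
  degreeSum-mono X⊆Y = ∑-mono-≤ λ u → ∑-mono-≤ λ v → bit-mono (X⊆Y u v)

  degreeSum-cong : {X Y : Graph n} → X ≐ Y → degreeSum X ≡ degreeSum Y
  degreeSum-cong X≐Y = sum-cong-≗ λ u → sum-cong-≗ λ v → cong bit (X≐Y u v)

  degreeSum-⊕ : (X Y : Graph n) → degreeSum (X ⊕ Y) ≤ degreeSum X + degreeSum Y
  degreeSum-⊕ X Y = begin
    degreeSum (X ⊕ Y)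
      ≤⟨ ∑-mono-≤ (λ u → ∑-mono-≤ λ v → bit-∨ (adj X u v) (adj Y u v)) ⟩
    ∑[ u < n ] ∑[ v < n ] (bit (adj X u v) + bit (adj Y u v))
      ≡⟨ sum-cong-≗ (λ u → ∑-distrib-+ (λ v → bit (adj X u v)) (λ v → bit (adj Y u v))) ⟩
    ∑[ u < n ] (degree X u + degree Y u)
      ≡⟨ ∑-distrib-+ (degree X) (degree Y) ⟩
    degreeSum X + degreeSum Y
      ∎
    where
    open ≤-Reasoning
    bit-∨ : ∀ a b → bit (a ∨ b) ≤ bit a + bit b
    bit-∨ true  _ = m≤m+n 1 _
    bit-∨ false _ = ≤-refl

  degreeSum-∩-∖ : (X Y : Graph n) → degreeSum (X ∩ Y) + degreeSum (X ∖ Y) ≡ degreeSum X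
  degreeSum-∩-∖ X Y = begin
    degreeSum (X ∩ Y) + degreeSum (X ∖ Y)
      ≡⟨ ∑-distrib-+ (degree (X ∩ Y)) (degree (X ∖ Y)) ⟨
    ∑[ u < n ] (degree (X ∩ Y) u + degree (X ∖ Y) u)
      ≡⟨ sum-cong-≗ (λ u → ∑-distrib-+ (λ v → bit (adj (X ∩ Y) u v))
                                         (λ v → bit (adj (X ∖ Y) u v))) ⟨
    ∑[ u < n ] ∑[ v < n ] (bit (adj (X ∩ Y) u v) + bit (adj (X ∖ Y) u v))
      ≡⟨ sum-cong-≗ (λ u → sum-cong-≗ λ v → bit-split (adj X u v) (adj Y u v)) ⟩
    degreeSum X
      ∎
    where
    open ≡-Reasoning
    bit-split : ∀ a b → bit (a ∧ b) + bit (a ∧ not b) ≡ bit a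
    bit-split false _     = refl
    bit-split true  true  = refl
    bit-split true  false = refl

  1≤degree : (X : Graph n) {u v : Fin n} → Adj X u v → 1 ≤ degree X u
  1≤degree X {u} {v} uv = subst (λ b → bit b ≤ degree X u) uv (≤-∑ _ v)

  2≤degree : (X : Graph n) {u a a′ : Fin n} → a ≢ a′ → Adj X u a → Adj X u a′ → 2 ≤ degree X u
  2≤degree X {u} {a} {a′} a≢a′ ua ua′ =
    subst₂ (λ b b′ → bit b + bit b′ ≤ degree X u) ua ua′ (+≤-∑ _ a a′ a≢a′)

  2≤degreeSum : (X : Graph n) {u v : Fin n} → Adj X u v → 2 ≤ degreeSum X
  2≤degreeSum X uv =
    ≤-trans (+-mono-≤ (1≤degree X uv) (1≤degree X (Adj-sym X uv))) (+≤-∑ _ _ _ (Adj⇒≢ X uv))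

  degreeSum-∖-edge : (X : Graph n) {u v : Fin n} → Adj X u v →
    2 + degreeSum (X ∖ edge u v) ≤ degreeSum X
  degreeSum-∖-edge X {u} {v} uv = subst (2 + degreeSum (X ∖ edge u v) ≤_) (degreeSum-∩-∖ X (edge u v))
    (+-monoˡ-≤ _ (2≤degreeSum (X ∩ edge u v) (∩-intro X (edge u v) uv (edge-adj (Adj⇒≢ X uv)))))

  degreeSum-symmetrise : ∀ R → let S = ∑[ u < n ] ∑[ v < n ] bit (R u v) in
    degreeSum (symmetrise R) ≤ S + S
  degreeSum-symmetrise R = begin
    degreeSum (symmetrise R)
      ≤⟨ ∑-mono-≤ (λ u → ∑-mono-≤ λ v → bit-∨-∧ (R u v) (R v u) _) ⟩
    ∑[ u < n ] ∑[ v < n ] (bit (R u v) + bit (R v u))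
      ≡⟨ sum-cong-≗ (λ u → ∑-distrib-+ (λ v → bit (R u v)) (λ v → bit (R v u))) ⟩
    ∑[ u < n ] (∑[ v < n ] bit (R u v) + ∑[ v < n ] bit (R v u))
      ≡⟨ ∑-distrib-+ (λ u → ∑[ v < n ] bit (R u v)) (λ u → ∑[ v < n ] bit (R v u)) ⟩
    S + ∑[ u < n ] ∑[ v < n ] bit (R v u)
      ≡⟨ cong (S +_) (∑-comm (λ u v → bit (R v u))) ⟩
    S + S
      ∎
    where
    open ≤-Reasoning
    S = ∑[ u < n ] ∑[ v < n ] bit (R u v)
    bit-∨-∧ : ∀ a b c → bit ((a ∨ b) ∧ c) ≤ bit a + bit b
    bit-∨-∧ true  _     true  = m≤m+n 1 _
    bit-∨-∧ true  _     false = z≤n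
    bit-∨-∧ false true  true  = ≤-refl
    bit-∨-∧ false true  false = z≤n
    bit-∨-∧ false false _     = z≤n

  degreeSum-edge : (p r : Fin n) → degreeSum (edge p r) ≤ 2
  degreeSum-edge p r = subst (λ k → degreeSum (edge p r) ≤ k + k) (∑∑-indicator p r)
    (degreeSum-symmetrise (λ u v → u == p ∧ v == r))

  bit-adj-by-order : (X : Graph n) (u v : Fin n) →
    bit (adj X u v) ≡ bit (does (u <? v) ∧ adj X u v) + bit (does (v <? u) ∧ adj X v u)
  bit-adj-by-order X u v with <-cmp u v
  ... | tri< u<v _ _ rewrite dec-true (u <? v) u<v | dec-false (v <? u) (<-asym u<v) =
    ≡.sym (+-identityʳ _)
  ... | tri≈ _ refl _ rewrite dec-false (u <? u) (<-irrefl refl) = cong bit (irrefl X u)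
  ... | tri> _ _ v<u rewrite dec-false (u <? v) (<-asym v<u) | dec-true (v <? u) v<u =
    cong bit (sym X u v)

  size≡∑∑ : (X : Graph n) → size X ≡ ∑[ u < n ] ∑[ v < n ] bit (does (u <? v) ∧ adj X u v)
  size≡∑∑ X = trans (length-filter-concatMap P? (λ u → map (u ,_) (allFin n)) (λ u → u))
    (sum-cong-≗ λ u → trans (cong (length ∘ filter P?) (map-tabulate (λ v → v) (u ,_)))
                            (length-filter-tabulate P? (u ,_)))
    where
    P? = λ (e : Fin n × Fin n) → (proj₁ e <? proj₂ e) ×-dec T? (adj X (proj₁ e) (proj₂ e))

  degreeSum≡2*size : (X : Graph n) → degreeSum X ≡ 2 * size X
  degreeSum≡2*size X = begin
    degreeSum X
      ≡⟨ sum-cong-≗ (λ u → trans (sum-cong-≗ (bit-adj-by-order X u))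
                                 (∑-distrib-+ (lower u) (λ v → lower v u))) ⟩
    ∑[ u < n ] (∑[ v < n ] lower u v + ∑[ v < n ] lower v u)
      ≡⟨ ∑-distrib-+ (λ u → ∑[ v < n ] lower u v) (λ u → ∑[ v < n ] lower v u) ⟩
    E + ∑[ u < n ] ∑[ v < n ] lower v u
      ≡⟨ cong (E +_) (∑-comm (λ u v → lower v u)) ⟩
    E + E
      ≡⟨ cong₂ _+_ (size≡∑∑ X) (trans (*-identityˡ (size X)) (size≡∑∑ X)) ⟨
    2 * size X
      ∎
    where
    open ≡-Reasoning
    lower : Fin n → Fin n → ℕ
    lower u v = bit (does (u <? v) ∧ adj X u v)
    E = ∑[ u < n ] ∑[ v < n ] lower u v

  size-cong : {X Y : Graph n} → X ≐ Y → size X ≡ size Y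
  size-cong {X} {Y} X≐Y = *-cancelˡ-≡ (size X) (size Y) 2
    (trans (≡.sym (degreeSum≡2*size X)) (trans (degreeSum-cong {X} {Y} X≐Y) (degreeSum≡2*size Y)))

  degreeSum≤⇒size≤ : {X Y : Graph n} → degreeSum X ≤ degreeSum Y → size X ≤ size Y
  degreeSum≤⇒size≤ {X} {Y} X≤Y =
    *-cancelˡ-≤ {size X} {size Y} 2 (subst₂ _≤_ (degreeSum≡2*size X) (degreeSum≡2*size Y) X≤Y)

  -- Minimum Δ-completions by exhaustive search over adjacency matrices, coded as subsets of Fin (n * n)

  fromCode : Subset (n * n) → Graph n
  fromCode s = symmetrise λ u v → lookup s (combine u v)

  code : Graph n → Subset (n * n)
  code X = Vec.tabulate (uncurry (adj X) ∘ remQuot n)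

  lookup-code : (X : Graph n) (u v : Fin n) → lookup (code X) (combine u v) ≡ adj X u v
  lookup-code X u v =
    trans (lookup∘tabulate _ (combine u v)) (cong (uncurry (adj X)) (remQuot-combine u v))

  fromCode-code : (X : Graph n) → fromCode (code X) ≐ X
  fromCode-code X u v rewrite lookup-code X u v | lookup-code X v u | sym X v u with u ≟ v
  ... | yes refl = trans (∧-zeroʳ _) (≡.sym (irrefl X u))
  ... | no _     = trans (∧-identityʳ _) (∨-idem _)

  isΔCompletion? : (G F : Graph n) → Dec (IsΔCompletion G F)
  isΔCompletion? G F =
    all? (λ u → all? λ v → adj? F u v →-dec (adj G u v ≟ᵇ false)) ×-dec all? (covered? (G ⊕ F))

  IsΔCompletion-resp : (G : Graph n) {F F′ : Graph n} → F ≐ F′ →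
    IsΔCompletion G F → IsΔCompletion G F′
  IsΔCompletion-resp G {F} {F′} F≐F′ (nonEdges , covers) =
    (λ u v uv → nonEdges u v (trans (F≐F′ u v) uv)) ,
    (λ z → Covered-mono {G ⊕ F} {G ⊕ F′} (⊕-monoʳ G {F} {F′} (≐⇒⊆ {F} {F′} F≐F′))
                        z (covers z))

  ΔCompletionOfSize≤? : (G : Graph n) (k : ℕ) → Dec (∃[ F ] (IsΔCompletion G F × size F ≤ k))
  ΔCompletionOfSize≤? G k =
    map′ decode encode (anySubset? λ s → isΔCompletion? G (fromCode s) ×-dec size (fromCode s) ≤? k)
    where
    Coded : Subset (n * n) → Set
    Coded s = IsΔCompletion G (fromCode s) × size (fromCode s) ≤ k
    decode : ∃[ s ] Coded s → ∃[ F ] (IsΔCompletion G F × size F ≤ k)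
    decode (s , completion , small) = fromCode s , completion , small
    encode : ∃[ F ] (IsΔCompletion G F × size F ≤ k) → ∃[ s ] Coded s
    encode (F , completion , small) =
      code F ,
      IsΔCompletion-resp G {F} {fromCode (code F)}
        (≐-sym {fromCode (code F)} {F} (fromCode-code F)) completion ,
      subst (_≤ k) (≡.sym (size-cong {fromCode (code F)} {F} (fromCode-code F))) small

  minimumΔCompletion : (G : Graph n) → ∃[ F ] IsΔCompletion G F → ∃[ F ] IsMinΔCompletion G F
  minimumΔCompletion G (F₀ , completion₀)
    with least-upward-closed (ΔCompletionOfSize≤? G) (λ i≤j (F , c , F≤i) → F , c , ≤-trans F≤i i≤j)
                             (F₀ , completion₀ , ≤-refl)
  ... | k , (F , completion , F≤k) , least =
    F , completion , λ F′ completion′ → ≤-trans F≤k (least (F′ , completion′ , ≤-refl))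

module _ {n : ℕ} (G : Graph n) where

  CommonNeighbour : Fin n → Fin n → Set
  CommonNeighbour u v = ∃[ w ] (Adj G u w × Adj G w v)

  CommonNeighbour-sym : {u v : Fin n} → CommonNeighbour u v → CommonNeighbour v u
  CommonNeighbour-sym (w , uw , wv) = w , Adj-sym G wv , Adj-sym G uw

  commonNeighbour? : (u v : Fin n) → Dec (CommonNeighbour u v)
  commonNeighbour? u v = any? λ w → adj? G u w ×-dec adj? G w v

  AtDistanceTwo : Graph n → Set
  AtDistanceTwo A = ∀ u v → Adj A u v → adj G u v ≡ false × CommonNeighbour u v

  AtDistanceTwo⇒NonEdgesOf : {A : Graph n} → AtDistanceTwo A → NonEdgesOf G A
  AtDistanceTwo⇒NonEdgesOf A₂ u v uv = proj₁ (A₂ u v uv)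

  AtDistanceTwo-covered : {A : Graph n} → AtDistanceTwo A → ∀ {u v} → Adj A u v → Covered (G ⊕ A) u
  AtDistanceTwo-covered {A} A₂ {u} {v} uv with A₂ u v uv
  ... | _ , w , uw , wv = v , w , Y⊆X⊕Y G A u v uv , X⊆X⊕Y G A u w uw , X⊆X⊕Y G A v w (Adj-sym G wv)

  Covered-⊕-mono : {A A′ : Graph n} → A ⊆ A′ → ∀ z → Covered (G ⊕ A) z → Covered (G ⊕ A′) z
  Covered-⊕-mono {A} {A′} A⊆A′ =
    Covered-mono {X = G ⊕ A} {Y = G ⊕ A′} (⊕-monoʳ G {A} {A′} A⊆A′)

  CompletionWithin : ℕ → Set
  CompletionWithin k = ∃[ A ] (AtDistanceTwo A × TriangleCovered (G ⊕ A) × degreeSum A ≤ k)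

  CompletionWithin-mono : ∀ {k k′} → k ≤ k′ → CompletionWithin k → CompletionWithin k′
  CompletionWithin-mono k≤k′ (A , A₂ , covers , A≤k) = A , A₂ , covers , ≤-trans A≤k k≤k′

  -- Cherries and their closing edges

  record Cherry : Set where
    field
      p q r : Fin n
      pq    : Adj G p q
      qr    : Adj G q r
      p≢r   : p ≢ r

  open Cherry

  _∈ᶜ_ : Fin n → Cherry → Set
  x ∈ᶜ c = x ≡ p c ⊎ x ≡ q c ⊎ x ≡ r c

  closingEdge : Cherry → Graph n
  closingEdge c = edge (p c) (r c) ∖ G

  closeCherry : Graph n → Cherry → Graph n
  closeCherry A c = A ⊕ closingEdge c

  A⊆closeCherry : (A : Graph n) (c : Cherry) → A ⊆ closeCherry A c
  A⊆closeCherry A c = X⊆X⊕Y A (closingEdge c)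

  closeCherry-closes : (A : Graph n) (c : Cherry) → Adj (G ⊕ closeCherry A c) (p c) (r c)
  closeCherry-closes A c with adj? G (p c) (r c)
  ... | yes pr = X⊆X⊕Y G (closeCherry A c) _ _ pr
  ... | no ¬pr = Y⊆X⊕Y G (closeCherry A c) _ _
    (Y⊆X⊕Y A (closingEdge c) _ _ (∖-intro (edge (p c) (r c)) G (edge-adj (p≢r c)) ¬pr))

  closeCherry-covers : (A : Graph n) (c : Cherry) → ∀ {x} → x ∈ᶜ c → Covered (G ⊕ closeCherry A c) x
  closeCherry-covers A c = triangle-covered (G ⊕ closeCherry A c)
    (X⊆X⊕Y G (closeCherry A c) _ _ (pq c)) (X⊆X⊕Y G (closeCherry A c) _ _ (qr c)) (closeCherry-closes A c)

  closeCherry-atDistanceTwo : {A : Graph n} (c : Cherry) → AtDistanceTwo A → AtDistanceTwo (closeCherry A c)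
  closeCherry-atDistanceTwo {A} c A₂ u v uv with ⊕-elim A (closingEdge c) uv
  ... | inj₁ A-uv = A₂ u v A-uv
  ... | inj₂ closing-uv with ∖-elim (edge (p c) (r c)) G closing-uv
  ...   | pr-uv , ¬G-uv with edge-ends {p = p c} {r = r c} {u = u} {v = v} pr-uv
  ...     | inj₁ (refl , refl) = ¬-not ¬G-uv , q c , pq c , qr c
  ...     | inj₂ (refl , refl) = ¬-not ¬G-uv , CommonNeighbour-sym (q c , pq c , qr c)

  degreeSum-closeCherry : (A : Graph n) (c : Cherry) → degreeSum (closeCherry A c) ≤ degreeSum A + 2
  degreeSum-closeCherry A c = ≤-trans (degreeSum-⊕ A (closingEdge c)) (+-monoʳ-≤ (degreeSum A) (begin
    degreeSum (closingEdge c)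
      ≤⟨ degreeSum-mono {X = closingEdge c} {Y = edge (p c) (r c)} (X∖Y⊆X (edge (p c) (r c)) G) ⟩
    degreeSum (edge (p c) (r c))
      ≤⟨ degreeSum-edge (p c) (r c) ⟩
    2 ∎))
    where open ≤-Reasoning

  #uncovered : Graph n → ℕ
  #uncovered A = ∑[ z < n ] bit (does (¬? (covered? (G ⊕ A) z)))

  #uncovered-closeCherry : {A : Graph n} {z : Fin n} (c : Cherry) → z ∈ᶜ c → ¬ Covered (G ⊕ A) z →
    #uncovered (closeCherry A c) < #uncovered A
  #uncovered-closeCherry {A} {z} c z∈c ¬cz = ∑-mono-<
    (λ y → bit-does-mono (λ ¬c₁ c₀ → ¬c₁ (mono y c₀)) (uncovered? A₁ y) (uncovered? A y)) z
    (bit-does-< (λ ¬c₁ → ¬c₁ (closeCherry-covers A c z∈c)) ¬cz (uncovered? A₁ z) (uncovered? A z))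
    where
    A₁ = closeCherry A c
    uncovered? = λ (X : Graph n) y → ¬? (covered? (G ⊕ X) y)
    mono = Covered-⊕-mono {A} {A₁} (A⊆closeCherry A c)

  2*#uncovered≤degreeSum : {A B : Graph n} → (∀ z → ¬ Covered (G ⊕ A) z → TwoNeighbours B z) →
    2 * #uncovered A ≤ degreeSum B
  2*#uncovered≤degreeSum {A} {B} two = begin
    2 * #uncovered A                  ≡⟨ *-distribˡ-sum 2 uncovered ⟩
    ∑[ z < n ] (2 * uncovered z)      ≤⟨ ∑-mono-≤ pointwise ⟩
    degreeSum B                       ∎
    where
    open ≤-Reasoning
    uncovered : Fin n → ℕ
    uncovered z = bit (does (¬? (covered? (G ⊕ A) z)))
    pointwise : ∀ z → 2 * uncovered z ≤ degree B z
    pointwise z with covered? (G ⊕ A) z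
    ... | yes _  = z≤n
    ... | no ¬cz = let a , a′ , a≢a′ , za , za′ = two z ¬cz in 2≤degree B a≢a′ za za′

  -- The exchange argument

  cherryEnds : Graph n
  cherryEnds = symmetrise λ u v → does (commonNeighbour? u v)

  cherryEnds-common : {u v : Fin n} → Adj cherryEnds u v → CommonNeighbour u v
  cherryEnds-common {u} {v} uv =
    [ does⇒ (commonNeighbour? u v) , CommonNeighbour-sym ∘ does⇒ (commonNeighbour? v u) ]′
      (symmetrise-elim (λ u v → does (commonNeighbour? u v)) {u} {v} uv)

  common⇒cherryEnds : {u v : Fin n} → u ≢ v → CommonNeighbour u v → Adj cherryEnds u v
  common⇒cherryEnds {u} {v} u≢v uv =
    symmetrise-intro (λ u v → does (commonNeighbour? u v)) (dec-true (commonNeighbour? u v) uv) u≢v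

  -- B holds the "bad" edges of a completion, those not yet traded for closing edges.
  data Backed (A B : Graph n) (z : Fin n) : Set where
    two-bad-edges       : TwoNeighbours B z → Backed A B z
    bad-edge-to-covered : ∀ {a} → Adj B z a → Covered (G ⊕ A) a → Backed A B z
    bad-path            : ∀ {a b} → Adj B z a → Adj B a b → Adj G z b → Backed A B z

  Backs : Graph n → Graph n → Set
  Backs A B = ∀ z → ¬ Covered (G ⊕ A) z → Backed A B z

  Backs-mono : {A A₁ B B₁ : Graph n} → A ⊆ A₁ →
    (∀ u v → Adj B u v → ¬ Covered (G ⊕ A₁) u → Adj B₁ u v) → Backs A B → Backs A₁ B₁
  Backs-mono {A} {A₁} A⊆A₁ keep backs z ¬cz with backs z (¬cz ∘ Covered-⊕-mono {A} {A₁} A⊆A₁ z)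
  ... | two-bad-edges (a , a′ , a≢a′ , za , za′) =
    two-bad-edges (a , a′ , a≢a′ , keep z a za ¬cz , keep z a′ za′ ¬cz)
  ... | bad-edge-to-covered za ca =
    bad-edge-to-covered (keep _ _ za ¬cz) (Covered-⊕-mono {A} {A₁} A⊆A₁ _ ca)
  ... | bad-path {a} za ab zb with covered? (G ⊕ A₁) a
  ...   | yes ca = bad-edge-to-covered (keep _ _ za ¬cz) ca
  ...   | no ¬ca = bad-path (keep _ _ za ¬cz) (keep _ _ ab ¬ca) zb

  ∩-cherryEnds-atDistanceTwo : {F : Graph n} → NonEdgesOf G F → AtDistanceTwo (F ∩ cherryEnds)
  ∩-cherryEnds-atDistanceTwo {F} nonEdges u v uv =
    let F-uv , ends-uv = ∩-elim F cherryEnds uv in nonEdges u v F-uv , cherryEnds-common ends-uv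

  ∖-cherryEnds-backs : {F : Graph n} → IsΔCompletion G F → Backs (F ∩ cherryEnds) (F ∖ cherryEnds)
  ∖-cherryEnds-backs {F} (nonEdges , covers) = backed
    where
    A = F ∩ cherryEnds
    B = F ∖ cherryEnds

    G⊆G⊕A : ∀ {u v} → Adj G u v → Adj (G ⊕ A) u v
    G⊆G⊕A = X⊆X⊕Y G A _ _

    A-covered : ∀ {u v} → Adj A u v → Covered (G ⊕ A) u
    A-covered = AtDistanceTwo-covered {A} (∩-cherryEnds-atDistanceTwo {F} nonEdges)

    B-no-common : ∀ {u v} → Adj B u v → ¬ CommonNeighbour u v
    B-no-common uv cn =
      let F-uv , ¬ends-uv = ∖-elim F cherryEnds uv in ¬ends-uv (common⇒cherryEnds (Adj⇒≢ F F-uv) cn)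

    mixed : ∀ {z a b} → Adj B z a → Adj G z b → Adj (G ⊕ F) a b → Backed A B z
    mixed {b = b} za zb ab with ⊕-split G F cherryEnds ab
    ... | inj₁ ab-G        = contradiction (b , zb , Adj-sym G ab-G) (B-no-common za)
    ... | inj₂ (inj₁ ab-A) = bad-edge-to-covered za (A-covered ab-A)
    ... | inj₂ (inj₂ ab-B) = bad-path za ab-B zb

    backed : Backs A B
    backed z ¬cz with covers z
    ... | a , b , za , zb , ab with ⊕-split G F cherryEnds za | ⊕-split G F cherryEnds zb
    ... | inj₂ (inj₁ za-A) | _                = contradiction (A-covered za-A) ¬cz
    ... | _                | inj₂ (inj₁ zb-A) = contradiction (A-covered zb-A) ¬cz
    ... | inj₂ (inj₂ za-B) | inj₂ (inj₂ zb-B) = two-bad-edges (a , b , Adj⇒≢ (G ⊕ F) ab , za-B , zb-B)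
    ... | inj₂ (inj₂ za-B) | inj₁ zb-G        = mixed za-B zb-G ab
    ... | inj₁ za-G        | inj₂ (inj₂ zb-B) = mixed zb-B za-G (Adj-sym (G ⊕ F) ab)
    ... | inj₁ za-G        | inj₁ zb-G with ⊕-split G F cherryEnds ab
    ...   | inj₁ ab-G        = contradiction (a , b , G⊆G⊕A za-G , G⊆G⊕A zb-G , G⊆G⊕A ab-G) ¬cz
    ...   | inj₂ (inj₁ ab-A) =
      contradiction (a , b , G⊆G⊕A za-G , G⊆G⊕A zb-G , Y⊆X⊕Y G A _ _ ab-A) ¬cz
    ...   | inj₂ (inj₂ ab-B) = contradiction (z , Adj-sym G za-G , zb-G) (B-no-common ab-B)

  module _ (components≥3 : ComponentsAtLeast3 G) where

    no-isolated-edge : ∀ {x w} → Adj G x w →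
      ¬ (∃[ y ] (y ≢ w × Adj G x y)) → ¬ (∃[ y ] (y ≢ x × Adj G w y)) → ⊥
    no-isolated-edge {x} {w} xw x-isolated w-isolated with components≥3 x
    ... | a , b , c , a≢b , a≢c , b≢c , x⇝a , x⇝b , x⇝c =
      no-three-in-two a≢b a≢c b≢c (inside x⇝a) (inside x⇝b) (inside x⇝c)
      where
      closed : ∀ {y z} → y ≡ x ⊎ y ≡ w → Adj G y z → z ≡ x ⊎ z ≡ w
      closed {z = z} (inj₁ refl) yz with z ≟ w
      ... | yes z≡w = inj₂ z≡w
      ... | no z≢w  = contradiction (z , z≢w , yz) x-isolated
      closed {z = z} (inj₂ refl) yz with z ≟ x
      ... | yes z≡x = inj₁ z≡x
      ... | no z≢x  = contradiction (z , z≢x , yz) w-isolated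
      inside : ∀ {t} → Reach G x t → t ≡ x ⊎ t ≡ w
      inside x⇝t = Reach-closed G closed x⇝t (inj₁ refl)

    cherry-through : ∀ {x w} → Adj G x w → Σ Cherry λ c → x ∈ᶜ c × w ∈ᶜ c
    cherry-through {x} {w} xw with any? (λ y → ¬? (y ≟ w) ×-dec adj? G x y)
    ... | yes (y , y≢w , xy) =
      record { p = w ; q = x ; r = y ; pq = Adj-sym G xw ; qr = xy ; p≢r = y≢w ∘ ≡.sym } ,
      inj₂ (inj₁ refl) , inj₁ refl
    ... | no x-isolated with any? (λ y → ¬? (y ≟ x) ×-dec adj? G w y)
    ...   | yes (y , y≢x , wy) =
      record { p = x ; q = w ; r = y ; pq = xw ; qr = wy ; p≢r = y≢x ∘ ≡.sym } ,
      inj₁ refl , inj₂ (inj₁ refl)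
    ...   | no w-isolated = ⊥-elim (no-isolated-edge xw x-isolated w-isolated)

    neighbour : ∀ x → ∃[ w ] Adj G x w
    neighbour x with components≥3 x
    ... | a , b , _ , a≢b , _ , _ , x⇝a , x⇝b , _ with a ≟ x
    ...   | yes refl = Reach⇒neighbour G x⇝b (a≢b ∘ ≡.sym)
    ...   | no a≢x   = Reach⇒neighbour G x⇝a a≢x

    cherry-at : ∀ x → Σ Cherry (x ∈ᶜ_)
    cherry-at x = let c , x∈c , _ = cherry-through (proj₂ (neighbour x)) in c , x∈c

    cover-uncovered : (A : Graph n) → AtDistanceTwo A →
      CompletionWithin (degreeSum A + 2 * #uncovered A)
    cover-uncovered A A₂ = go A A₂ (<-wellFounded (#uncovered A))
      where
      go : (A : Graph n) → AtDistanceTwo A → Acc _<_ (#uncovered A) →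
        CompletionWithin (degreeSum A + 2 * #uncovered A)
      go A A₂ (acc smaller) with all? (covered? (G ⊕ A))
      ... | yes covers = A , A₂ , covers , m≤m+n _ _
      ... | no ¬covers with ¬∀⟶∃¬ n _ (covered? (G ⊕ A)) ¬covers
      ...   | z , ¬cz = CompletionWithin-mono (+-transfer (degreeSum-closeCherry A c) budget)
                          (go A₁ (closeCherry-atDistanceTwo {A} c A₂) (smaller fewer))
        where
        c = proj₁ (cherry-at z)
        A₁ = closeCherry A c
        fewer : #uncovered A₁ < #uncovered A
        fewer = #uncovered-closeCherry {A} c (proj₂ (cherry-at z)) ¬cz
        budget : 2 + 2 * #uncovered A₁ ≤ 2 * #uncovered A
        budget = subst (_≤ 2 * #uncovered A) (*-suc 2 (#uncovered A₁)) (*-monoʳ-≤ 2 fewer)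

    ΔCompletion-exists : ∃[ F ] IsΔCompletion G F
    ΔCompletion-exists =
      let A , A₂ , covers , _ = cover-uncovered ∅ (λ _ _ ())
      in  A , AtDistanceTwo⇒NonEdgesOf {A} A₂ , covers

    record Peeled (A B : Graph n) : Set where
      constructor peeled
      field
        A₁ B₁          : Graph n
        atDistanceTwo₁ : AtDistanceTwo A₁
        backs₁         : Backs A₁ B₁
        budget         : degreeSum A₁ + degreeSum B₁ ≤ degreeSum A + degreeSum B
        shrinks        : degreeSum B₁ < degreeSum B

    peel-bad-edge-to-covered : ∀ {A B z a} → AtDistanceTwo A → Backs A B →
      Adj B z a → Covered (G ⊕ A) a → Peeled A B
    peel-bad-edge-to-covered {A} {B} {z} {a} A₂ backs za ca =
      peeled A₁ B₁ (closeCherry-atDistanceTwo {A} c A₂)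
        (Backs-mono {A} {A₁} {B} {B₁} (A⊆closeCherry A c) keep backs)
        (+-transfer (degreeSum-closeCherry A c) removed) (≤-trans (m≤n+m _ 1) removed)
      where
      c = proj₁ (cherry-at z)
      A₁ = closeCherry A c
      B₁ = B ∖ edge z a
      cz₁ : Covered (G ⊕ A₁) z
      cz₁ = closeCherry-covers A c (proj₂ (cherry-at z))
      ca₁ : Covered (G ⊕ A₁) a
      ca₁ = Covered-⊕-mono {A} {A₁} (A⊆closeCherry A c) a ca
      keep : ∀ u v → Adj B u v → ¬ Covered (G ⊕ A₁) u → Adj B₁ u v
      keep u v uv ¬cu = ∖-edge-keeps B uv (λ { refl → ¬cu cz₁ }) (λ { refl → ¬cu ca₁ })
      removed : 2 + degreeSum B₁ ≤ degreeSum B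
      removed = degreeSum-∖-edge B za

    -- The closing edge of a cherry through zb covers z and b, that of a cherry at a covers a;
    -- the bad edges za and ab pay for both.
    peel-bad-path : ∀ {A B z a b} → AtDistanceTwo A → Backs A B →
      Adj B z a → Adj B a b → Adj G z b → Peeled A B
    peel-bad-path {A} {B} {z} {a} {b} A₂ backs za ab zb =
      peeled A₁ B₁ (closeCherry-atDistanceTwo {A₀} c₁ (closeCherry-atDistanceTwo {A} c₀ A₂))
        (Backs-mono {A} {A₁} {B} {B₁} A⊆A₁ keep backs)
        (+-transfer grown removed) (≤-trans (m≤n+m _ 3) removed)
      where
      c₀ = proj₁ (cherry-through zb)
      c₁ = proj₁ (cherry-at a)
      A₀ = closeCherry A c₀
      A₁ = closeCherry A₀ c₁
      B₀ = B ∖ edge z a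
      B₁ = B₀ ∖ edge a b
      A⊆A₁ : A ⊆ A₁
      A⊆A₁ u v = A⊆closeCherry A₀ c₁ u v ∘ A⊆closeCherry A c₀ u v
      covered₁ : ∀ {x} → x ∈ᶜ c₀ → Covered (G ⊕ A₁) x
      covered₁ x∈c₀ =
        Covered-⊕-mono {A₀} {A₁} (A⊆closeCherry A₀ c₁) _ (closeCherry-covers A c₀ x∈c₀)
      keep : ∀ u v → Adj B u v → ¬ Covered (G ⊕ A₁) u → Adj B₁ u v
      keep u v uv ¬cu = ∖-edge-keeps B₀ (∖-edge-keeps B uv u≢z u≢a) u≢a u≢b
        where
        u≢z : u ≢ z
        u≢z refl = ¬cu (covered₁ (proj₁ (proj₂ (cherry-through zb))))
        u≢b : u ≢ b
        u≢b refl = ¬cu (covered₁ (proj₂ (proj₂ (cherry-through zb))))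
        u≢a : u ≢ a
        u≢a refl = ¬cu (closeCherry-covers A₀ c₁ (proj₂ (cherry-at a)))
      ab₀ : Adj B₀ a b
      ab₀ = ∖-intro B (edge z a) ab λ e →
        [ (λ (a≡z , _) → Adj⇒≢ B za (≡.sym a≡z)) , (λ (_ , b≡z) → Adj⇒≢ G zb (≡.sym b≡z)) ]′
          (edge-ends e)
      grown : degreeSum A₁ ≤ degreeSum A + 4
      grown = ≤-trans (degreeSum-closeCherry A₀ c₁)
        (≤-trans (+-monoˡ-≤ 2 (degreeSum-closeCherry A c₀)) (≤-reflexive (+-assoc (degreeSum A) 2 2)))
      removed : 4 + degreeSum B₁ ≤ degreeSum B
      removed = ≤-trans (+-monoʳ-≤ 2 (degreeSum-∖-edge B₀ ab₀)) (degreeSum-∖-edge B za)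

    peel : ∀ {A B z} → AtDistanceTwo A → Backs A B → ¬ Covered (G ⊕ A) z → ¬ TwoNeighbours B z →
      Peeled A B
    peel {z = z} A₂ backs ¬cz ¬two with backs z ¬cz
    ... | two-bad-edges two         = contradiction two ¬two
    ... | bad-edge-to-covered za ca = peel-bad-edge-to-covered A₂ backs za ca
    ... | bad-path za ab zb         = peel-bad-path A₂ backs za ab zb

    complete-backed : (A B : Graph n) → AtDistanceTwo A → Backs A B →
      CompletionWithin (degreeSum A + degreeSum B)
    complete-backed A B A₂ backs = go A B A₂ backs (<-wellFounded (degreeSum B))
      where
      go : (A B : Graph n) → AtDistanceTwo A → Backs A B → Acc _<_ (degreeSum B) →
        CompletionWithin (degreeSum A + degreeSum B)
      go A B A₂ backs (acc smaller)
        with any? (λ z → ¬? (covered? (G ⊕ A) z) ×-dec ¬? (twoNeighbours? B z))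
      ... | yes (z , ¬cz , ¬two) with peel {A} {B} A₂ backs ¬cz ¬two
      ...   | peeled A₁ B₁ atDistanceTwo₁ backs₁ budget shrinks =
        CompletionWithin-mono budget (go A₁ B₁ atDistanceTwo₁ backs₁ (smaller shrinks))
      go A B A₂ backs _ | no none =
        CompletionWithin-mono (+-monoʳ-≤ (degreeSum A) (2*#uncovered≤degreeSum {A} {B} two))
          (cover-uncovered A A₂)
        where
        two : ∀ z → ¬ Covered (G ⊕ A) z → TwoNeighbours B z
        two z ¬cz = decidable-stable (twoNeighbours? B z) λ ¬two → none (z , ¬cz , ¬two)

    distanceTwoCompletion : {F : Graph n} → IsΔCompletion G F → CompletionWithin (degreeSum F)
    distanceTwoCompletion {F} completion = subst CompletionWithin (degreeSum-∩-∖ F cherryEnds)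
      (complete-backed (F ∩ cherryEnds) (F ∖ cherryEnds)
        (∩-cherryEnds-atDistanceTwo {F} (proj₁ completion)) (∖-cherryEnds-backs completion))

lemma4p1 : ∀ {n : ℕ} (G : Graph n) → ComponentsAtLeast3 G →
    ∃[ F ] (IsMinΔCompletion G F ×
      (∀ (u v : Fin n) → Adj F u v → ∃[ w ] (Adj G u w × Adj G w v)))
lemma4p1 G components≥3 with minimumΔCompletion G (ΔCompletion-exists G components≥3)
... | F , F-completion , F-minimum with distanceTwoCompletion G components≥3 {F} F-completion
... | A , A₂ , A-covers , A≤F =
  A , ((AtDistanceTwo⇒NonEdgesOf G {A} A₂ , A-covers) , A-minimum) , λ u v uv → proj₂ (A₂ u v uv)
  where
  A-minimum : ∀ F′ → IsΔCompletion G F′ → size A ≤ size F′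
  A-minimum F′ completion′ =
    ≤-trans (degreeSum≤⇒size≤ {X = A} {Y = F} A≤F) (F-minimum F′ completion′)
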